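{- Let $N$ be a positive perfect square and let $H$ be the undirected unweighted graph with vertex set the disjoint union of $A=\{a[i,j]\}$, $B=\{b[i,j,k]\}$, $C=\{c[i,j,k]\}$, $D=\{d[i,j]\}$, where indices $i,j,x,y$ range over $[\sqrt N]$ and $k,z$ over $\{0,1\}$, and whose edges are exactly: $\{b[i,j,k],b[x,y,z]\}$ iff exactly one of $i=x$, $j=y$ holds; $\{c[i,j,k],c[x,y,z]\}$ iff exactly one of $i=x$, $j=y$ holds; $\{a[i,j],b[x,y,z]\}$ iff $i=x$ and $z=0$; $\{b[i,j,k],c[x,y,z]\}$ iff $i=x$ and $j=y$; $\{c[i,j,k],d[x,y]\}$ iff $j=y$ and $k=0$ (no other edges). Let $M$ be an arbitrary binary $\sqrt N\times\sqrt N\times\sqrt N$ array, and let $G\supseteq H$ be obtained by adding the edge $\{a[i,j],b[i,y,1]\}$ for all $i,j,y$ with $M[i,j,y]=1$, and the edge $\{c[i,y,1],d[x,y]\}$ for all $i,x,y$ with $M[i,x,y]=1$. For indices $i,j,x,y\in[\sqrt N]$ with $i\ne x$ and $j\ne y$, let $F=\{\{a[i,j],b[i,y,0]\},\{c[i,y,0],d[x,y]\}\}$ and $F'=\{\{a[i,j],b[i,y,1]\},\{c[i,y,1],d[x,y]\}\}$. Then the graph $(G-F)\cup F'$, obtained from $G$ by deleting the two edges of $F$ and adding the two pairs of $F'$ as edges, has diameter $3$.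
   Context: The diameter of an unweighted graph is the maximum over vertex pairs of the shortest-path distance (number of edges). -}

module Defs where

open import Data.Nat using (ℕ; zero; suc; _≤_)
open import Data.Fin using (Fin)
open import Data.Bool using (Bool; true; false)
open import Data.Product using (_×_; Σ; ∃; ∃-syntax; _,_)
open import Data.Sum using (_⊎_)
open import Data.Empty using (⊥)
open import Relation.Nullary using (¬_)
open import Relation.Binary.PropositionalEquality using (_≡_)

data Walk {V : Set} (E : V → V → Set) : V → V → ℕ → Set where
  here : ∀ {u} → Walk E u u zero
  step : ∀ {u v w k} → E u v → Walk E v w k → Walk E u w (suc k)

DistLe : {V : Set} → (V → V → Set) → V → V → ℕ → Set
DistLe E u v d = ∃[ k ] (k ≤ d × Walk E u v k)

DistGe : {V : Set} → (V → V → Set) → V → V → ℕ → Set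
DistGe E u v d = ∀ k → Walk E u v k → d ≤ k

HasDiameter : {V : Set} → (V → V → Set) → ℕ → Set
HasDiameter {V} E d =
  (∀ (u v : V) → DistLe E u v d) × (∃[ u ] ∃[ v ] DistGe E u v d)

SamePair : {V : Set} → V → V → V → V → Set
SamePair u v p q = (u ≡ p × v ≡ q) ⊎ (u ≡ q × v ≡ p)

-- The construction.  n = √N, indices range over Fin n, k,z over Bool
-- (false = 0, true = 1).

data V (n : ℕ) : Set where
  a : Fin n → Fin n → V n
  b : Fin n → Fin n → Bool → V n
  c : Fin n → Fin n → Bool → V n
  d : Fin n → Fin n → V n

ExactlyOne : Set → Set → Set
ExactlyOne P Q = (P × ¬ Q) ⊎ (¬ P × Q)

HBase : ∀ {n} → V n → V n → Set
HBase (b i j k) (b x y z) = ExactlyOne (i ≡ x) (j ≡ y)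
HBase (c i j k) (c x y z) = ExactlyOne (i ≡ x) (j ≡ y)
HBase (a i j)   (b x y z) = i ≡ x × z ≡ false
HBase (b i j k) (c x y z) = i ≡ x × j ≡ y
HBase (c i j k) (d x y)   = j ≡ y × k ≡ false
HBase _         _         = ⊥

H : ∀ {n} → V n → V n → Set
H u v = HBase u v ⊎ HBase v u

AddBase : ∀ {n} → (Fin n → Fin n → Fin n → Bool) → V n → V n → Set
AddBase M (a i j) (b x y z) = i ≡ x × z ≡ true × M i j y ≡ true
AddBase M (c i y z) (d x w) = y ≡ w × z ≡ true × M i x y ≡ true
AddBase M _ _ = ⊥

G : ∀ {n} → (Fin n → Fin n → Fin n → Bool) → V n → V n → Set
G M u v = H u v ⊎ (AddBase M u v ⊎ AddBase M v u)

InF : ∀ {n} → (i j x y : Fin n) → V n → V n → Set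
InF i j x y u v =
  SamePair u v (a i j) (b i y false) ⊎ SamePair u v (c i y false) (d x y)

InF' : ∀ {n} → (i j x y : Fin n) → V n → V n → Set
InF' i j x y u v =
  SamePair u v (a i j) (b i y true) ⊎ SamePair u v (c i y true) (d x y)

G' : ∀ {n} → (Fin n → Fin n → Fin n → Bool) → (i j x y : Fin n) →
     V n → V n → Set
G' M i j x y u v = (G M u v × ¬ InF i j x y u v) ⊎ InF' i j x y u v

{-# OPTIONS --safe #-}
module Submission where

-- Lower bound: every edge of G′ joins vertices in the same or in consecutive
-- layers A, B, C, D, so any walk from a[i,j] to d[x,y] has at least 3 edges.
-- Upper bound: each edge of F is replaced by its twin in F′, so every a[p,q]
-- still sees some b[p,s,·] for each s, and every d[r,q] some c[s,q,·] for each s.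
-- B and C are joined by the matching b[p,q,·] c[p,q,·], and within B (and C)
-- any two vertices are at distance ≤ 2 through a common row or column;
-- combining these gives a path of length ≤ 3 between any two vertices.

open import Defs
open import Data.Nat using (ℕ; _<_; _≤_; _+_; suc; z≤n; s≤s)
open import Data.Nat.Properties
  using (≤-trans; ≤-reflexive; n≤1+n; +-monoʳ-≤; +-suc; +-identityʳ)
open import Data.Fin using (Fin; _≟_)
open import Data.Bool using (Bool; true; false)
open import Data.Product using (_×_; Σ-syntax; _,_; proj₂)
import Data.Product as Product
open import Data.Product.Properties using (≡-dec)
open import Data.Unit using (⊤; tt)
open import Data.Empty using (⊥)
open import Data.Sum using (_⊎_; inj₁; inj₂)
import Data.Sum as Sum
open import Function using (_∘_)
open import Relation.Nullary using (¬_; yes; no)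
open import Relation.Binary.Definitions using (Symmetric; DecidableEquality)
open import Relation.Binary.PropositionalEquality using (_≡_; refl)

module _ {A : Set} {E : A → A → Set} where

  _∷ʳ_ : ∀ {u v w k} → Walk E u v k → E v w → Walk E u w (suc k)
  here     ∷ʳ e′ = step e′ here
  step e p ∷ʳ e′ = step e (p ∷ʳ e′)

  reverse : Symmetric E → ∀ {u v k} → Walk E u v k → Walk E v u k
  reverse E-sym here       = here
  reverse E-sym (step e p) = reverse E-sym p ∷ʳ E-sym e

  distLe-sym : Symmetric E → ∀ {u v m} → DistLe E u v m → DistLe E v u m
  distLe-sym E-sym (k , k≤m , p) = k , k≤m , reverse E-sym p

  distLe-∷ : ∀ {u v w m} → E u v → DistLe E v w m → DistLe E u w (suc m)
  distLe-∷ e (k , k≤m , p) = suc k , s≤s k≤m , step e p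

  distLe-∷ʳ : ∀ {u v w m} → DistLe E u v m → E v w → DistLe E u w (suc m)
  distLe-∷ʳ (k , k≤m , p) e = suc k , s≤s k≤m , p ∷ʳ e

  path₁ : ∀ {u v m} → E u v → DistLe E u v (1 + m)
  path₁ e = 1 , s≤s z≤n , step e here

  path₂ : ∀ {u v w m} → E u v → E v w → DistLe E u w (2 + m)
  path₂ e f = 2 , s≤s (s≤s z≤n) , step e (step f here)

  path₃ : ∀ {u v w t m} → E u v → E v w → E w t → DistLe E u t (3 + m)
  path₃ e f g = 3 , s≤s (s≤s (s≤s z≤n)) , step e (step f (step g here))

  walk-potential : (f : A → ℕ) → (∀ {u v} → E u v → f v ≤ suc (f u)) →
                   ∀ {u v k} → Walk E u v k → f v ≤ k + f u
  walk-potential f f-step here       = ≤-reflexive refl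
  walk-potential f f-step (step e p) =
    ≤-trans (walk-potential f f-step p)
            (≤-trans (+-monoʳ-≤ _ (f-step e)) (≤-reflexive (+-suc _ _)))

SamePair-sym : ∀ {A : Set} {u v p q : A} → SamePair u v p q → SamePair v u p q
SamePair-sym = Sum.swap ∘ Sum.map Product.swap Product.swap

SamePair-resp : ∀ {A : Set} {R : A → A → Set} → Symmetric R →
                ∀ {u v p q} → R p q → SamePair u v p q → R u v
SamePair-resp R-sym Rpq (inj₁ (refl , refl)) = Rpq
SamePair-resp R-sym Rpq (inj₂ (refl , refl)) = R-sym Rpq

Near : ℕ → ℕ → Set
Near l m = l ≤ suc m × m ≤ suc l

near-sym : Symmetric Near
near-sym = Product.swap

near-refl : ∀ {l} → Near l l
near-refl = n≤1+n _ , n≤1+n _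

near-suc : ∀ {l} → Near l (suc l)
near-suc = ≤-trans (n≤1+n _) (n≤1+n _) , ≤-reflexive refl

module _ {n : ℕ} where

  G-sym : ∀ {M} → Symmetric (G {n} M)
  G-sym (inj₁ e) = inj₁ (Sum.swap e)
  G-sym (inj₂ e) = inj₂ (Sum.swap e)

  InF-sym : ∀ {i j x y} → Symmetric (InF {n} i j x y)
  InF-sym (inj₁ s) = inj₁ (SamePair-sym s)
  InF-sym (inj₂ s) = inj₂ (SamePair-sym s)

  InF′-sym : ∀ {i j x y} → Symmetric (InF' {n} i j x y)
  InF′-sym (inj₁ s) = inj₁ (SamePair-sym s)
  InF′-sym (inj₂ s) = inj₂ (SamePair-sym s)

  layer : V n → ℕ
  layer (a _ _)   = 0
  layer (b _ _ _) = 1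
  layer (c _ _ _) = 2
  layer (d _ _)   = 3

  HBase⇒near : ∀ {u v : V n} → HBase u v → Near (layer u) (layer v)
  HBase⇒near {a _ _}   {b _ _ _} _ = near-suc
  HBase⇒near {b _ _ _} {b _ _ _} _ = near-refl
  HBase⇒near {b _ _ _} {c _ _ _} _ = near-suc
  HBase⇒near {c _ _ _} {c _ _ _} _ = near-refl
  HBase⇒near {c _ _ _} {d _ _}   _ = near-suc
  HBase⇒near {a _ _}   {a _ _}   ()
  HBase⇒near {a _ _}   {c _ _ _} ()
  HBase⇒near {a _ _}   {d _ _}   ()
  HBase⇒near {b _ _ _} {a _ _}   ()
  HBase⇒near {b _ _ _} {d _ _}   ()
  HBase⇒near {c _ _ _} {a _ _}   ()
  HBase⇒near {c _ _ _} {b _ _ _} ()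
  HBase⇒near {d _ _}   ()

  AddBase⇒near : ∀ M {u v : V n} → AddBase M u v → Near (layer u) (layer v)
  AddBase⇒near M {a _ _}   {b _ _ _} _ = near-suc
  AddBase⇒near M {c _ _ _} {d _ _}   _ = near-suc
  AddBase⇒near M {a _ _}   {a _ _}   ()
  AddBase⇒near M {a _ _}   {c _ _ _} ()
  AddBase⇒near M {a _ _}   {d _ _}   ()
  AddBase⇒near M {b _ _ _} ()
  AddBase⇒near M {c _ _ _} {a _ _}   ()
  AddBase⇒near M {c _ _ _} {b _ _ _} ()
  AddBase⇒near M {c _ _ _} {c _ _ _} ()
  AddBase⇒near M {d _ _}   ()

  InF′⇒near : ∀ {i j x y} {u v : V n} → InF' i j x y u v → Near (layer u) (layer v)
  InF′⇒near (inj₁ s) = SamePair-resp near-sym near-suc s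
  InF′⇒near (inj₂ s) = SamePair-resp near-sym near-suc s

  G′⇒near : ∀ {M i j x y} {u v : V n} → G' M i j x y u v → Near (layer u) (layer v)
  G′⇒near (inj₁ (inj₁ (inj₁ e) , _))        = HBase⇒near e
  G′⇒near (inj₁ (inj₁ (inj₂ e) , _))        = near-sym (HBase⇒near e)
  G′⇒near {M} (inj₁ (inj₂ (inj₁ e) , _))    = AddBase⇒near M e
  G′⇒near {M} (inj₁ (inj₂ (inj₂ e) , _))    = near-sym (AddBase⇒near M e)
  G′⇒near (inj₂ f)                          = InF′⇒near f

  Outer : V n → Set
  Outer (a _ _)   = ⊤
  Outer (b _ _ _) = ⊥
  Outer (c _ _ _) = ⊥
  Outer (d _ _)   = ⊤

  InF⇒outer : ∀ {i j x y} {u v : V n} → InF i j x y u v → Outer u ⊎ Outer v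
  InF⇒outer (inj₁ (inj₁ (refl , _))) = inj₁ tt
  InF⇒outer (inj₁ (inj₂ (_ , refl))) = inj₂ tt
  InF⇒outer (inj₂ (inj₁ (_ , refl))) = inj₂ tt
  InF⇒outer (inj₂ (inj₂ (refl , _))) = inj₁ tt

module _ {n : ℕ} (M : Fin n → Fin n → Fin n → Bool) (i j x y : Fin n) where

  private
    E : V n → V n → Set
    E = G' M i j x y

  G′-sym : Symmetric E
  G′-sym (inj₁ (e , e∉F)) = inj₁ (G-sym e , e∉F ∘ InF-sym)
  G′-sym (inj₂ e∈F′)      = inj₂ (InF′-sym e∈F′)

  distLe-rev : ∀ {u v m} → DistLe E u v m → DistLe E v u m
  distLe-rev = distLe-sym G′-sym

  inner-edge : ∀ {u v} → HBase u v → ¬ Outer u → ¬ Outer v → E u v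
  inner-edge e ¬u ¬v = inj₁ (inj₁ (inj₁ e) , Sum.[ ¬u , ¬v ] ∘ InF⇒outer)

  b-b-edge : ∀ {p q k p′ q′ k′} → ExactlyOne (p ≡ p′) (q ≡ q′) →
             E (b p q k) (b p′ q′ k′)
  b-b-edge e = inner-edge e (λ ()) (λ ())

  c-c-edge : ∀ {p q k p′ q′ k′} → ExactlyOne (p ≡ p′) (q ≡ q′) →
             E (c p q k) (c p′ q′ k′)
  c-c-edge e = inner-edge e (λ ()) (λ ())

  b-c-edge : ∀ {p q k k′} → E (b p q k) (c p q k′)
  b-c-edge = inner-edge (refl , refl) (λ ()) (λ ())

  private
    _≟³_ : DecidableEquality (Fin n × Fin n × Fin n)
    _≟³_ = ≡-dec _≟_ (≡-dec _≟_ _≟_)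

  a-b-adjacent : (p q s : Fin n) → Σ[ k ∈ Bool ] E (a p q) (b p s k)
  a-b-adjacent p q s with (p , q , s) ≟³ (i , j , y)
  ... | yes refl = true , inj₂ (inj₁ (inj₁ (refl , refl)))
  ... | no ≢ijy  = false , inj₁ (inj₁ (inj₁ (refl , refl)) , ≢ijy ∘ InF-ab)
    where
    InF-ab : InF i j x y (a p q) (b p s false) → (p , q , s) ≡ (i , j , y)
    InF-ab (inj₁ (inj₁ (refl , refl))) = refl
    InF-ab (inj₁ (inj₂ (() , _)))
    InF-ab (inj₂ (inj₁ (() , _)))
    InF-ab (inj₂ (inj₂ (() , _)))

  c-d-adjacent : (s r q : Fin n) → Σ[ k ∈ Bool ] E (c s q k) (d r q)
  c-d-adjacent s r q with (s , r , q) ≟³ (i , x , y)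
  ... | yes refl = true , inj₂ (inj₂ (inj₁ (refl , refl)))
  ... | no ≢ixy  = false , inj₁ (inj₁ (inj₁ (refl , refl)) , ≢ixy ∘ InF-cd)
    where
    InF-cd : InF i j x y (c s q false) (d r q) → (s , r , q) ≡ (i , x , y)
    InF-cd (inj₁ (inj₁ (() , _)))
    InF-cd (inj₁ (inj₂ (() , _)))
    InF-cd (inj₂ (inj₁ (refl , refl))) = refl
    InF-cd (inj₂ (inj₂ (() , _)))

  distLe-bb : ∀ p q k p′ q′ k′ {m} → DistLe E (b p q k) (b p′ q′ k′) (2 + m)
  distLe-bb p q k p′ q′ k′ with p ≟ p′ | q ≟ q′
  ... | yes refl | yes refl = path₂ (b-c-edge {k′ = false}) (G′-sym b-c-edge)
  ... | yes refl | no q≢q′  = path₁ (b-b-edge (inj₁ (refl , q≢q′)))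
  ... | no p≢p′  | yes refl = path₁ (b-b-edge (inj₂ (p≢p′ , refl)))
  ... | no p≢p′  | no q≢q′  =
    path₂ (b-b-edge {k′ = false} (inj₁ (refl , q≢q′)))
          (b-b-edge (inj₂ (p≢p′ , refl)))

  distLe-cc : ∀ p q k p′ q′ k′ {m} → DistLe E (c p q k) (c p′ q′ k′) (2 + m)
  distLe-cc p q k p′ q′ k′ with p ≟ p′ | q ≟ q′
  ... | yes refl | yes refl = path₂ (G′-sym (b-c-edge {k = false})) b-c-edge
  ... | yes refl | no q≢q′  = path₁ (c-c-edge (inj₁ (refl , q≢q′)))
  ... | no p≢p′  | yes refl = path₁ (c-c-edge (inj₂ (p≢p′ , refl)))
  ... | no p≢p′  | no q≢q′  =
    path₂ (c-c-edge {k′ = false} (inj₁ (refl , q≢q′)))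
          (c-c-edge (inj₂ (p≢p′ , refl)))

  distLe-aa : ¬ j ≡ y → ∀ p q p′ q′ → DistLe E (a p q) (a p′ q′) 3
  distLe-aa j≢y p q p′ q′ with p ≟ p′
  ... | yes refl = path₃ (proj₂ (a-b-adjacent p q j))
                         (b-b-edge (inj₁ (refl , j≢y)))
                         (G′-sym (proj₂ (a-b-adjacent p q′ y)))
  ... | no p≢p′  = path₃ (proj₂ (a-b-adjacent p q y))
                         (b-b-edge (inj₂ (p≢p′ , refl)))
                         (G′-sym (proj₂ (a-b-adjacent p′ q′ y)))

  distLe-ab : ∀ p q p′ q′ k′ → DistLe E (a p q) (b p′ q′ k′) 3
  distLe-ab p q p′ q′ k′ =
    distLe-∷ (proj₂ (a-b-adjacent p q q′)) (distLe-bb p q′ _ p′ q′ k′)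

  distLe-ac : ∀ p q p′ q′ k′ → DistLe E (a p q) (c p′ q′ k′) 3
  distLe-ac p q p′ q′ k′ with p ≟ p′
  ... | yes refl = path₂ (proj₂ (a-b-adjacent p q q′)) b-c-edge
  ... | no p≢p′  = path₃ (proj₂ (a-b-adjacent p q q′))
                         (b-b-edge {k′ = false} (inj₂ (p≢p′ , refl))) b-c-edge

  distLe-ad : ∀ p q r q′ → DistLe E (a p q) (d r q′) 3
  distLe-ad p q r q′ =
    path₃ (proj₂ (a-b-adjacent p q q′)) b-c-edge (proj₂ (c-d-adjacent p r q′))

  distLe-bc : ∀ p q k p′ q′ k′ → DistLe E (b p q k) (c p′ q′ k′) 3
  distLe-bc p q k p′ q′ k′ = distLe-∷ʳ (distLe-bb p q k p′ q′ false) b-c-edge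

  distLe-bd : ∀ p q k r q′ → DistLe E (b p q k) (d r q′) 3
  distLe-bd p q k r q′ with q ≟ q′
  ... | yes refl = path₂ b-c-edge (proj₂ (c-d-adjacent p r q))
  ... | no q≢q′  = path₃ (b-c-edge {k′ = false}) (c-c-edge (inj₁ (refl , q≢q′)))
                         (proj₂ (c-d-adjacent p r q′))

  distLe-cd : ∀ p q k r q′ → DistLe E (c p q k) (d r q′) 3
  distLe-cd p q k r q′ =
    distLe-∷ʳ (distLe-cc p q k p q′ _) (proj₂ (c-d-adjacent p r q′))

  distLe-dd : ¬ i ≡ x → ∀ r q r′ q′ → DistLe E (d r q) (d r′ q′) 3
  distLe-dd i≢x r q r′ q′ with q ≟ q′
  ... | yes refl = path₃ (G′-sym (proj₂ (c-d-adjacent i r q)))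
                         (c-c-edge (inj₂ (i≢x , refl)))
                         (proj₂ (c-d-adjacent x r′ q))
  ... | no q≢q′  = path₃ (G′-sym (proj₂ (c-d-adjacent i r q)))
                         (c-c-edge (inj₁ (refl , q≢q′)))
                         (proj₂ (c-d-adjacent i r′ q′))

  distLe-3 : ¬ i ≡ x → ¬ j ≡ y → ∀ u v → DistLe E u v 3
  distLe-3 i≢x j≢y (a p q)   (a p′ q′)    = distLe-aa j≢y p q p′ q′
  distLe-3 _   _   (a p q)   (b p′ q′ k′) = distLe-ab p q p′ q′ k′
  distLe-3 _   _   (a p q)   (c p′ q′ k′) = distLe-ac p q p′ q′ k′
  distLe-3 _   _   (a p q)   (d p′ q′)    = distLe-ad p q p′ q′
  distLe-3 _   _   (b p q k) (a p′ q′)    = distLe-rev (distLe-ab p′ q′ p q k)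
  distLe-3 _   _   (b p q k) (b p′ q′ k′) = distLe-bb p q k p′ q′ k′
  distLe-3 _   _   (b p q k) (c p′ q′ k′) = distLe-bc p q k p′ q′ k′
  distLe-3 _   _   (b p q k) (d p′ q′)    = distLe-bd p q k p′ q′
  distLe-3 _   _   (c p q k) (a p′ q′)    = distLe-rev (distLe-ac p′ q′ p q k)
  distLe-3 _   _   (c p q k) (b p′ q′ k′) = distLe-rev (distLe-bc p′ q′ k′ p q k)
  distLe-3 _   _   (c p q k) (c p′ q′ k′) = distLe-cc p q k p′ q′ k′
  distLe-3 _   _   (c p q k) (d p′ q′)    = distLe-cd p q k p′ q′
  distLe-3 _   _   (d p q)   (a p′ q′)    = distLe-rev (distLe-ad p′ q′ p q)
  distLe-3 _   _   (d p q)   (b p′ q′ k′) = distLe-rev (distLe-bd p′ q′ k′ p q)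
  distLe-3 _   _   (d p q)   (c p′ q′ k′) = distLe-rev (distLe-cd p′ q′ k′ p q)
  distLe-3 i≢x j≢y (d p q)   (d p′ q′)    = distLe-dd i≢x p q p′ q′

  distGe-ad : DistGe E (a i j) (d x y) 3
  distGe-ad k p =
    ≤-trans (walk-potential layer (proj₂ ∘ G′⇒near) p)
            (≤-reflexive (+-identityʳ k))

lemma13 : (n : ℕ) → 0 < n → (M : Fin n → Fin n → Fin n → Bool) →
          (i j x y : Fin n) → ¬ i ≡ x → ¬ j ≡ y →
          HasDiameter (G' M i j x y) 3
lemma13 n _ M i j x y i≢x j≢y =
  distLe-3 M i j x y i≢x j≢y , a i j , d x y , distGe-ad M i j x y
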